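{- Let $\bm a_1,\dots,\bm a_k$ be $r$-coloured permutations such that the triples $(\mathrm{des}(\bm a_i),\mathrm{comaj}(\bm a_i),\mathbf{col}(\bm a_i))$ are pairwise distinct. Then $\Psi(F_{\bm a_1}),\dots,\Psi(F_{\bm a_k})$ are linearly independent over $\mathbb{Q}$.
   Context: Fix $r\ge1$. An $r$-coloured permutation is a word $\bm a=\sigma_1^{\gamma_1}\cdots\sigma_n^{\gamma_n}$ ($n\ge0$) with distinct positive integers $\sigma_i$ and colours $\gamma_i\in\{0,\dots,r-1\}$. Coloured integers are ordered by $\sigma_1^{\gamma_1}<\sigma_2^{\gamma_2}$ iff either $\gamma_1=\gamma_2$ and $\sigma_1<\sigma_2$, or $\gamma_1>\gamma_2$ as integers. $\mathrm{Des}(\bm a)=\{i\in[n-1]:\sigma_i^{\gamma_i}>\sigma_{i+1}^{\gamma_{i+1}}\}$, with $0$ added if $n\ge1$ and $\gamma_1\ne0$; $\mathrm{Des}^*(\bm a)=\mathrm{Des}(\bm a)\setminus\{0\}$; $\mathrm{des}(\bm a)=|\mathrm{Des}(\bm a)|$; $\mathrm{comaj}(\bm a)=\sum_{i\in\mathrm{Des}(\bm a)}(n-i)$; $\mathbf{col}(\bm a)=(\mathrm{col}_0,\dots,\mathrm{col}_{r-1})$ with $\mathrm{col}_j=|\{i:\gamma_i=j\}|$. With commuting variables $x_i^{(j)}$ ($i\ge1$, $0\le j\le r-1$), $F_{\bm a}=\sum x_{i_1}^{(\gamma_1)}\cdots x_{i_n}^{(\gamma_n)}$ over $1\le i_1\le\dots\le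 i_n$ with $i_j<i_{j+1}$ whenever $j\in\mathrm{Des}^*(\bm a)$; $\mathrm{QSym}^{(r)}$ is the $\mathbb{Q}$-algebra spanned by all $F_{\bm a}$. For $m\ge1$, $\psi_m:\mathrm{QSym}^{(r)}\to\mathbb{Q}[p_0,\dots,p_{r-1},x]$ is the specialisation $x_i^{(0)}\mapsto x^{i-1}p_0$ for $1\le i\le m$; $x_i^{(j)}\mapsto x^{i-1}p_j$ for $1<i\le m$ and $1\le j\le r-1$; all other variables $\mapsto0$. Define $\Psi:\mathrm{QSym}^{(r)}\to\mathbb{Q}[\bm p,x][[t]]$ by $\Psi(F)=\sum_{m\ge1}\psi_m(F)t^{m-1}$. -}

module Defs where

open import Data.Nat using (ℕ; zero; suc; _∸_; _≤_; _≡ᵇ_; _<ᵇ_; _≤ᵇ_)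
open import Data.Nat.Properties using () renaming (_≟_ to _≟ℕ_)
open import Data.Nat using () renaming (_+_ to _+ℕ_)
open import Data.Bool.ListAction using (any)
open import Data.Nat.ListAction using (sum)
open import Data.Bool.Properties using (T?)
open import Data.Bool using (Bool; true; false; if_then_else_; _∧_; _∨_; not)
open import Data.Fin using (Fin; toℕ)
open import Data.List as L using (List; []; _∷_; _++_; length; filter; upTo; concatMap)
open import Data.Vec as V using (Vec)
open import Data.Vec.Properties using (≡-dec)
open import Data.Maybe using (Maybe; just; nothing)
open import Data.Product using (_×_; _,_; proj₁; proj₂)
open import Data.Integer using (+_)
open import Data.Rational using (ℚ; _/_; _+_; _*_; 0ℚ)
import Data.Fin as Fin
open import Relation.Binary.PropositionalEquality using (_≡_)
open import Relation.Nullary.Decidable using (does)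

record CPerm (r : ℕ) : Set where
  field
    n     : ℕ
    σ     : Fin n → ℕ
    γ     : Fin n → Fin r
    σ-pos : ∀ i → 1 ≤ σ i
    σ-inj : ∀ i j → σ i ≡ σ j → i ≡ j
open CPerm public

CInt : ℕ → Set
CInt r = ℕ × Fin r

_<ᶜ_ : ∀ {r} → CInt r → CInt r → Bool
(s₁ , g₁) <ᶜ (s₂ , g₂) = if toℕ g₁ ≡ᵇ toℕ g₂ then s₁ <ᵇ s₂ else toℕ g₂ <ᵇ toℕ g₁

word : ∀ {r} → CPerm r → List (CInt r)
word a = L.tabulate (λ i → σ a i , γ a i)

colours : ∀ {r} → CPerm r → List (Fin r)
colours a = L.tabulate (γ a)

desStarFrom : ∀ {r} → ℕ → List (CInt r) → List ℕ
desStarFrom k (x ∷ y ∷ w) = (if y <ᶜ x then k ∷ [] else []) ++ desStarFrom (suc k) (y ∷ w)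
desStarFrom k _ = []

DesStar : ∀ {r} → CPerm r → List ℕ
DesStar a = desStarFrom 1 (word a)

Des : ∀ {r} → CPerm r → List ℕ
Des a with colours a
... | []    = DesStar a
... | g ∷ _ = if toℕ g ≡ᵇ 0 then DesStar a else 0 ∷ DesStar a

des : ∀ {r} → CPerm r → ℕ
des a = length (Des a)

comaj : ∀ {r} → CPerm r → ℕ
comaj a = sum (L.map (λ i → n a ∸ i) (Des a))

col : ∀ {r} → CPerm r → Vec ℕ r
col a = V.tabulate (λ j → length (filter (λ g → toℕ g ≟ℕ toℕ j) (colours a)))

stat : ∀ {r} → CPerm r → ℕ × ℕ × Vec ℕ r
stat a = des a , comaj a , col a

-- Monomials p₀^{α₀}⋯p_{r-1}^{α_{r-1}} x^e of ℚ[p₀,…,p_{r-1},x]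

Mon : ℕ → Set
Mon r = Vec ℕ r × ℕ

oneMon : ∀ {r} → Mon r
oneMon = V.replicate _ 0 , 0

mulMon : ∀ {r} → Mon r → Mon r → Mon r
mulMon (α , e) (β , f) = V.zipWith _+ℕ_ α β , e +ℕ f

unitVec : ∀ {r} → Fin r → Vec ℕ r
unitVec j = V.updateAt (V.replicate _ 0) j (λ _ → 1)

-- ψ_m on a single variable x_i^{(j)}: nothing means "↦ 0"
--   x_i^{(0)} ↦ x^{i-1} p₀  (1 ≤ i ≤ m),  x_i^{(j)} ↦ x^{i-1} p_j  (1 < i ≤ m, j ≥ 1)
specVar : ∀ {r} → ℕ → ℕ → Fin r → Maybe (Mon r)
specVar m i j =
  if (1 ≤ᵇ i) ∧ (i ≤ᵇ m) ∧ ((toℕ j ≡ᵇ 0) ∨ (1 <ᵇ i))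
  then just (unitVec j , i ∸ 1) else nothing

mulM : ∀ {r} → Maybe (Mon r) → Maybe (Mon r) → Maybe (Mon r)
mulM (just μ) (just ν) = just (mulMon μ ν)
mulM _ _ = nothing

-- ψ_m of the monomial x_{i₁}^{(γ₁)} ⋯ x_{iₙ}^{(γₙ)}
specMono : ∀ {r} → ℕ → List ℕ → List (Fin r) → Maybe (Mon r)
specMono m (i ∷ is) (g ∷ gs) = mulM (specVar m i g) (specMono m is gs)
specMono m _ _ = just oneMon

-- all sequences (i₁,…,iₙ) ∈ {1,…,m}ⁿ (variables x_i with i > m are sent to 0 by ψ_m,
-- so only these index sequences contribute)
allSeqs : ℕ → ℕ → List (List ℕ)
allSeqs zero m = [] ∷ []
allSeqs (suc n) m = concatMap (λ v → L.map (v ∷_) (allSeqs n m)) (L.map suc (upTo m))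

elemℕ : ℕ → List ℕ → Bool
elemℕ k D = any (λ d → k ≡ᵇ d) D

admissibleFrom : List ℕ → ℕ → List ℕ → Bool
admissibleFrom D k (i ∷ j ∷ s) =
  (if elemℕ k D then i <ᵇ j else i ≤ᵇ j) ∧ admissibleFrom D (suc k) (j ∷ s)
admissibleFrom D k _ = true

monEq : ∀ {r} → Maybe (Mon r) → Mon r → Bool
monEq (just (α , e)) (β , f) = does (≡-dec _≟ℕ_ α β) ∧ (e ≡ᵇ f)
monEq nothing _ = false

-- coefficient of the monomial μ in ψ_m(F_a)
-- (number of admissible index sequences whose specialised monomial is μ)
ψcoeff : ∀ {r} → ℕ → CPerm r → Mon r → ℕ
ψcoeff m a μ =
  length (filter (λ s → T? (admissibleFrom (DesStar a) 1 s ∧ monEq (specMono m s (colours a)) μ))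
                 (allSeqs (n a) m)
         )

-- coefficient of t^d · μ in Ψ(F_a) = Σ_{m ≥ 1} ψ_m(F_a) t^{m-1}, as a rational number
Ψcoeff : ∀ {r} → CPerm r → ℕ → Mon r → ℚ
Ψcoeff a d μ = (+ ψcoeff (suc d) a μ) / 1

Σℚ : ∀ {k} → (Fin k → ℚ) → ℚ
Σℚ {zero} f = 0ℚ
Σℚ {suc k} f = f Fin.zero + Σℚ (λ i → f (Fin.suc i))

-- linear independence over ℚ of Ψ(F_{a₁}),…,Ψ(F_{a_k}) in ℚ[p,x][[t]]:
-- any ℚ-linear combination vanishing coefficientwise has all coefficients 0
LinIndepΨ : ∀ {r k} → (Fin k → CPerm r) → Set
LinIndepΨ {r} {k} a =
  (c : Fin k → ℚ) →
  (∀ (d : ℕ) (μ : Mon r) → Σℚ (λ i → c i * Ψcoeff (a i) d μ) ≡ 0ℚ) →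
  ∀ i → c i ≡ 0ℚ

-- Under ψ_m an index sequence admissible for Des*(a) climbs by at least one at every descent and, as
-- x_1^{(j)} ↦ 0 for j ≠ 0, starts at 2 when 0 ∈ Des(a); so it ends at or above 1 + des(a) and
-- must lie in [1, m].  Hence ψ_m(F_a) = 0 for m ≤ des(a), and ψ_{1+des(a)}(F_a) comes from the
-- unique minimal such sequence, whose monomial is p^{col(a)} x^{comaj(a)}.  Thus
-- Ψ(F_a) = t^{des(a)} p^{col(a)} x^{comaj(a)} + (terms of higher t-degree), and a family with
-- distinct leading terms is triangular, hence linearly independent.

module Submission where

open import Defs
open import Data.Bool using (Bool; true; false; if_then_else_; _∧_; _∨_; T)
open import Data.Bool.Properties using (T?; T-∧; T-∨; T-≡)
open import Data.Empty using (⊥; ⊥-elim)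
open import Data.Fin using (Fin; toℕ)
import Data.Fin as Fin
import Data.Fin.Properties as Finₚ
import Data.Integer as ℤ
open import Data.List using (List; []; _∷_; _++_; length; map; filter; upTo)
open import Data.List.Properties
  using (∷-injectiveˡ; length-map; length-tabulate; map-tabulate; filter-none; filter-some)
open import Data.List.Membership.Propositional using (_∈_; lose)
open import Data.List.Membership.Propositional.Properties
  using (∈-map⁺; ∈-upTo⁺; ∈-concatMap⁺)
open import Data.List.Relation.Binary.Pointwise using (Pointwise; []; _∷_)
open import Data.List.Relation.Unary.All as All using (All; []; _∷_)
import Data.List.Relation.Unary.All.Properties as Allₚ
open import Data.List.Relation.Unary.Any using (here)
open import Data.Maybe using (Maybe; just)
open import Data.Maybe.Properties using (just-injective)
open import Data.Nat using (ℕ; zero; suc; _+_; _*_; _∸_; _≤_; _<_; z≤n; s≤s; _≡ᵇ_; _<ᵇ_; _≤ᵇ_)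
open import Data.Nat.Induction using (<-rec)
open import Data.Nat.ListAction using (sum)
open import Data.Nat.Properties
open import Data.Nat.Tactic.RingSolver using (solve-∀)
open import Data.Product using (_×_; _,_; proj₁; proj₂)
open import Data.Rational as ℚ using (ℚ; _/_; 0ℚ; 1ℚ; 1/_; NonZero; ≢-nonZero)
import Data.Rational.Properties as ℚₚ
open import Data.Sum using (_⊎_; inj₁; inj₂)
open import Data.Vec as V using (Vec)
import Data.Vec.Properties as Vecₚ
open import Function using (_∘_)
open import Function.Bundles using (Equivalence)
open import Relation.Binary using (tri<; tri≈; tri>)
open import Relation.Binary.PropositionalEquality
open import Relation.Nullary using (yes; no; contradiction)
open import Relation.Nullary.Decidable using (dec-true; dec-false)

open Equivalence using (to; from)
open ≡-Reasoning

-- Triangular families over ℚ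

fromℕ≢0 : ∀ m → m ≢ 0 → (ℤ.+ m) / 1 ≢ 0ℚ
fromℕ≢0 zero m≢0 = contradiction refl m≢0
fromℕ≢0 (suc m) _ eq
  with subst NonZero eq (ℚₚ.pos⇒nonZero ((ℤ.+ suc m) / 1) {{ℚₚ.normalize-pos (suc m) 1}})
... | ()

Σℚ-zero : ∀ {k} (f : Fin k → ℚ) → (∀ j → f j ≡ 0ℚ) → Σℚ f ≡ 0ℚ
Σℚ-zero {zero} f _ = refl
Σℚ-zero {suc k} f f≡0 =
  cong₂ ℚ._+_ (f≡0 Fin.zero) (Σℚ-zero (λ j → f (Fin.suc j)) (λ j → f≡0 (Fin.suc j)))

Σℚ-single : ∀ {k} (f : Fin k → ℚ) i → (∀ j → j ≢ i → f j ≡ 0ℚ) → Σℚ f ≡ f i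
Σℚ-single {suc k} f Fin.zero others =
  trans (cong (f Fin.zero ℚ.+_) (Σℚ-zero (λ j → f (Fin.suc j)) (λ j → others (Fin.suc j) λ ())))
        (ℚₚ.+-identityʳ (f Fin.zero))
Σℚ-single {suc k} f (Fin.suc i) others =
  trans (cong (ℚ._+ Σℚ (λ j → f (Fin.suc j))) (others Fin.zero λ ()))
        (trans (ℚₚ.+-identityˡ _)
               (Σℚ-single (λ j → f (Fin.suc j)) i λ j j≢i → others (Fin.suc j) (j≢i ∘ Finₚ.suc-injective)))

*-cancelʳ-≢0 : ∀ p q → q ≢ 0ℚ → p ℚ.* q ≡ 0ℚ → p ≡ 0ℚ
*-cancelʳ-≢0 p q q≢0 pq≡0 = begin
  p                   ≡⟨ ℚₚ.*-identityʳ p ⟨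
  p ℚ.* 1ℚ            ≡⟨ cong (p ℚ.*_) (ℚₚ.*-inverseʳ q) ⟨
  p ℚ.* (q ℚ.* 1/ q)  ≡⟨ ℚₚ.*-assoc p q (1/ q) ⟨
  p ℚ.* q ℚ.* 1/ q    ≡⟨ cong (ℚ._* 1/ q) pq≡0 ⟩
  0ℚ ℚ.* 1/ q         ≡⟨ ℚₚ.*-zeroˡ (1/ q) ⟩
  0ℚ                  ∎
  where instance _ = ≢-nonZero q≢0

triangular⇒independent : ∀ {k} {M : Set} (f : Fin k → ℕ → M → ℚ) (deg : Fin k → ℕ) (top : Fin k → M) →
  (∀ i j → deg i ≡ deg j → top i ≡ top j → i ≡ j) →
  (∀ i → f i (deg i) (top i) ≢ 0ℚ) →
  (∀ i d μ → d < deg i → f i d μ ≡ 0ℚ) →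
  (∀ i μ → μ ≢ top i → f i (deg i) μ ≡ 0ℚ) →
  (c : Fin k → ℚ) → (∀ d μ → Σℚ (λ i → c i ℚ.* f i d μ) ≡ 0ℚ) → ∀ i → c i ≡ 0ℚ
triangular⇒independent f deg top distinct leading below off-top c combination≡0 i =
  <-rec (λ D → ∀ i → deg i ≡ D → c i ≡ 0ℚ) vanish (deg i) i refl
  where
  vanish : ∀ D → (∀ {D′} → D′ < D → ∀ j → deg j ≡ D′ → c j ≡ 0ℚ) → ∀ i → deg i ≡ D → c i ≡ 0ℚ
  vanish _ lower i refl = *-cancelʳ-≢0 (c i) _ (leading i) (begin
    c i ℚ.* f i (deg i) (top i)              ≡⟨ Σℚ-single (λ j → c j ℚ.* f j (deg i) (top i)) i others ⟨
    Σℚ (λ j → c j ℚ.* f j (deg i) (top i))   ≡⟨ combination≡0 (deg i) (top i) ⟩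
    0ℚ                                       ∎)
    where
    others : ∀ j → j ≢ i → c j ℚ.* f j (deg i) (top i) ≡ 0ℚ
    others j j≢i with <-cmp (deg j) (deg i)
    ... | tri< deg<deg _ _ = trans (cong (ℚ._* _) (lower deg<deg j refl)) (ℚₚ.*-zeroˡ (f j (deg i) (top i)))
    ... | tri> _ _ deg>deg = trans (cong (c j ℚ.*_) (below j (deg i) (top i) deg>deg)) (ℚₚ.*-zeroʳ (c j))
    ... | tri≈ _ deg≡deg _ = trans (cong (c j ℚ.*_) f≡0) (ℚₚ.*-zeroʳ (c j))
      where
      f≡0 : f j (deg i) (top i) ≡ 0ℚ
      f≡0 = subst (λ d → f j d (top i) ≡ 0ℚ) deg≡deg
              (off-top j (top i) λ top≡top → j≢i (distinct j i deg≡deg (sym top≡top)))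

-- Admissible index sequences

descentAt : Bool → ℕ → List ℕ
descentAt b k = if b then k ∷ [] else []

indicator : Bool → ℕ
indicator b = if b then 1 else 0

-- the condition on i_k, i_{k+1} in an admissible sequence, with b = (k ∈ Des*)
ascends : Bool → ℕ → ℕ → Bool
ascends b i j = if b then i <ᵇ j else i ≤ᵇ j

desStarFrom-≥ : ∀ {r} k (w : List (CInt r)) → All (k ≤_) (desStarFrom k w)
desStarFrom-≥ k [] = []
desStarFrom-≥ k (x ∷ []) = []
desStarFrom-≥ k (x ∷ y ∷ w) =
  Allₚ.++⁺ (descentAt-≥ (y <ᶜ x)) (All.map (≤-trans (n≤1+n k)) (desStarFrom-≥ (suc k) (y ∷ w)))
  where
  descentAt-≥ : ∀ b → All (k ≤_) (descentAt b k)
  descentAt-≥ true = ≤-refl ∷ []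
  descentAt-≥ false = []

elemℕ-below : ∀ k D → All (k <_) D → elemℕ k D ≡ false
elemℕ-below k [] [] = refl
elemℕ-below k (d ∷ D) (k<d ∷ k<D) rewrite dec-false (k ≟ d) (<⇒≢ k<d) = elemℕ-below k D k<D

elemℕ-descentAt : ∀ b k D → All (k <_) D → elemℕ k (descentAt b k ++ D) ≡ b
elemℕ-descentAt true k D _ rewrite dec-true (k ≟ k) refl = refl
elemℕ-descentAt false k D k<D = elemℕ-below k D k<D

elemℕ-descentAt-> : ∀ b k D j → k < j → elemℕ j (descentAt b k ++ D) ≡ elemℕ j D
elemℕ-descentAt-> true k D j k<j rewrite dec-false (j ≟ k) (>⇒≢ k<j) = refl
elemℕ-descentAt-> false k D j k<j = refl

admissibleFrom-cong : ∀ {D D′} k s → (∀ j → k ≤ j → elemℕ j D ≡ elemℕ j D′) →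
  admissibleFrom D k s ≡ admissibleFrom D′ k s
admissibleFrom-cong k [] _ = refl
admissibleFrom-cong k (i ∷ []) _ = refl
admissibleFrom-cong k (i ∷ j ∷ s) D≗D′ =
  cong₂ (λ b rest → ascends b i j ∧ rest)
    (D≗D′ k ≤-refl) (admissibleFrom-cong (suc k) (j ∷ s) (λ l k<l → D≗D′ l (<⇒≤ k<l)))

admissibleAfter : ∀ {r} → CInt r → ℕ → List (CInt r) → List ℕ → Bool
admissibleAfter x i (y ∷ w) (j ∷ s) = ascends (y <ᶜ x) i j ∧ admissibleAfter y j w s
admissibleAfter x i _ _ = true

admissibleFrom-desStarFrom : ∀ {r} k (x : CInt r) w i s → length s ≡ length w →
  admissibleFrom (desStarFrom k (x ∷ w)) k (i ∷ s) ≡ admissibleAfter x i w s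
admissibleFrom-desStarFrom k x [] i [] _ = refl
admissibleFrom-desStarFrom k x (y ∷ w) i (j ∷ s) len =
  cong₂ (λ b rest → ascends b i j ∧ rest)
    (elemℕ-descentAt (y <ᶜ x) k D (desStarFrom-≥ (suc k) (y ∷ w)))
    (trans (admissibleFrom-cong (suc k) (j ∷ s) (elemℕ-descentAt-> (y <ᶜ x) k D))
           (admissibleFrom-desStarFrom (suc k) y w j s (suc-injective len)))
  where D = desStarFrom (suc k) (y ∷ w)

descentsAfter : ∀ {r} → CInt r → List (CInt r) → ℕ
descentsAfter x [] = 0
descentsAfter x (y ∷ w) = indicator (y <ᶜ x) + descentsAfter y w

length-desStarFrom : ∀ {r} k (x : CInt r) w → length (desStarFrom k (x ∷ w)) ≡ descentsAfter x w
length-desStarFrom k x [] = refl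
length-desStarFrom k x (y ∷ w) with y <ᶜ x
... | true = cong suc (length-desStarFrom (suc k) y w)
... | false = length-desStarFrom (suc k) y w

minimalAfter : ∀ {r} → ℕ → CInt r → List (CInt r) → List ℕ
minimalAfter c x [] = []
minimalAfter c x (y ∷ w) = c + indicator (y <ᶜ x) ∷ minimalAfter (c + indicator (y <ᶜ x)) y w

length-minimalAfter : ∀ {r} c (x : CInt r) w → length (minimalAfter c x w) ≡ length w
length-minimalAfter c x [] = refl
length-minimalAfter c x (y ∷ w) = cong suc (length-minimalAfter _ y w)

ascends⇒+indicator≤ : ∀ b i j → T (ascends b i j) → i + indicator b ≤ j
ascends⇒+indicator≤ true i j i<j = subst (_≤ j) (+-comm 1 i) (<ᵇ⇒< i j i<j)
ascends⇒+indicator≤ false i j i≤j = subst (_≤ j) (sym (+-identityʳ i)) (≤ᵇ⇒≤ i j i≤j)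

ascends-+indicator : ∀ b i → T (ascends b i (i + indicator b))
ascends-+indicator true i = <⇒<ᵇ (subst (i <_) (+-comm 1 i) ≤-refl)
ascends-+indicator false i = ≤⇒≤ᵇ (m≤m+n i 0)

admissibleAfter-minimal : ∀ {r} c (x : CInt r) w → T (admissibleAfter x c w (minimalAfter c x w))
admissibleAfter-minimal c x [] = _
admissibleAfter-minimal c x (y ∷ w) =
  from T-∧ (ascends-+indicator (y <ᶜ x) c , admissibleAfter-minimal _ y w)

-- An admissible sequence starting at or above c climbs by at least one at every descent,
-- so it ends at or above c + #descents, with equality only for the minimal one.
admissibleAfter-bound : ∀ {r} c m (x : CInt r) w i s → length s ≡ length w →
  T (admissibleAfter x i w s) → c ≤ i → All (_≤ m) (i ∷ s) →
  c + descentsAfter x w ≤ m × (c + descentsAfter x w ≡ m → i ∷ s ≡ c ∷ minimalAfter c x w)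
admissibleAfter-bound c m x [] i [] _ _ c≤i (i≤m ∷ []) =
  subst (_≤ m) (sym (+-identityʳ c)) (≤-trans c≤i i≤m) ,
  λ c+0≡m → cong (_∷ []) (≤-antisym (subst (i ≤_) (trans (sym c+0≡m) (+-identityʳ c)) i≤m) c≤i)
admissibleAfter-bound c m x (y ∷ w) i (j ∷ s) len adm c≤i (_ ∷ j≤m ∷ s≤m)
  with to (T-∧ {ascends (y <ᶜ x) i j}) adm
... | step , adm′ =
  subst (_≤ m) (+-assoc c δ _) bound ,
  λ eq → let tail≡ = minimal (trans (+-assoc c δ _) eq) in
         cong₂ _∷_ (≤-antisym (+-cancelʳ-≤ δ i c (≤-trans i+δ≤j (≤-reflexive (∷-injectiveˡ tail≡)))) c≤i)
                   tail≡
  where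
  δ = indicator (y <ᶜ x)
  i+δ≤j : i + δ ≤ j
  i+δ≤j = ascends⇒+indicator≤ (y <ᶜ x) i j step
  ih = admissibleAfter-bound (c + δ) m y w j s (suc-injective len) adm′
         (≤-trans (+-monoˡ-≤ δ c≤i) i+δ≤j) (j≤m ∷ s≤m)
  bound = proj₁ ih
  minimal = proj₂ ih

-- The specialisation ψ_m

Survives : ∀ {r} → ℕ → ℕ → Fin r → Set
Survives m i g = T ((1 ≤ᵇ i) ∧ (i ≤ᵇ m) ∧ ((toℕ g ≡ᵇ 0) ∨ (1 <ᵇ i)))

survives-bounds : ∀ {r} m i (g : Fin r) → Survives m i g → 1 ≤ i × i ≤ m
survives-bounds m i g sv =
  let 1≤i , rest = to (T-∧ {1 ≤ᵇ i}) sv in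
  ≤ᵇ⇒≤ 1 i 1≤i , ≤ᵇ⇒≤ i m (proj₁ (to (T-∧ {i ≤ᵇ m}) rest))

-- 1 if 0 ∈ Des, i.e. if the first colour is nonzero
des₀ : ∀ {r} → List (Fin r) → ℕ
des₀ [] = 0
des₀ (g ∷ _) = if toℕ g ≡ᵇ 0 then 0 else 1

survives-des₀ : ∀ {r} m i (g : Fin r) gs → Survives m i g → suc (des₀ (g ∷ gs)) ≤ i
survives-des₀ m i g gs sv with to (T-∧ {1 ≤ᵇ i}) sv
... | 1≤i , rest with toℕ g ≡ᵇ 0 | proj₂ (to (T-∧ {i ≤ᵇ m}) rest)
...   | true  | _   = ≤ᵇ⇒≤ 1 i 1≤i
...   | false | 1<i = <ᵇ⇒< 1 i 1<i

survives-bounded : ∀ {r} m s (gs : List (Fin r)) → Pointwise (Survives m) s gs → All (λ i → 1 ≤ i × i ≤ m) s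
survives-bounded m [] [] [] = []
survives-bounded m (i ∷ s) (g ∷ gs) (sv ∷ svs) = survives-bounds m i g sv ∷ survives-bounded m s gs svs

colourVector : ∀ {r} → List (Fin r) → Vec ℕ r
colourVector [] = V.replicate _ 0
colourVector (g ∷ gs) = V.zipWith _+_ (unitVec g) (colourVector gs)

specMono-survives : ∀ {r} m s (gs : List (Fin r)) → Pointwise (Survives m) s gs →
  specMono m s gs ≡ just (colourVector gs , sum (map (_∸ 1) s))
specMono-survives m [] [] [] = refl
specMono-survives m (i ∷ s) (g ∷ gs) (sv ∷ svs) = cong₂ mulM (if-T sv) (specMono-survives m s gs svs)
  where
  if-T : ∀ {A : Set} {b} {x y : A} → T b → (if b then x else y) ≡ x
  if-T {b = true} _ = refl

specMono≡just⇒survives : ∀ {r} m s (gs : List (Fin r)) {ν} → length s ≡ length gs →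
  specMono m s gs ≡ just ν → Pointwise (Survives m) s gs
specMono≡just⇒survives m [] [] _ _ = []
specMono≡just⇒survives m (i ∷ s) (g ∷ gs) len eq
  with (1 ≤ᵇ i) ∧ (i ≤ᵇ m) ∧ ((toℕ g ≡ᵇ 0) ∨ (1 <ᵇ i)) in survives | specMono m s gs in rest
... | true | just _ = from T-≡ survives ∷ specMono≡just⇒survives m s gs (suc-injective len) rest

lookup-unitVec : ∀ {r} (g j : Fin r) → V.lookup (unitVec g) j ≡ indicator (toℕ g ≡ᵇ toℕ j)
lookup-unitVec g j with g Finₚ.≟ j
... | yes refl = trans (Vecₚ.lookup∘updateAt g (V.replicate _ 0))
                       (cong indicator (sym (dec-true (toℕ g ≟ toℕ g) refl)))
... | no g≢j = trans (Vecₚ.lookup∘updateAt′ j g (g≢j ∘ sym) (V.replicate _ 0))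
                     (trans (Vecₚ.lookup-replicate j 0)
                            (cong indicator (sym (dec-false (toℕ g ≟ toℕ j) (g≢j ∘ Finₚ.toℕ-injective)))))

lookup-colourVector : ∀ {r} (gs : List (Fin r)) j →
  V.lookup (colourVector gs) j ≡ length (filter (λ g → toℕ g ≟ toℕ j) gs)
lookup-colourVector [] j = Vecₚ.lookup-replicate j 0
lookup-colourVector (g ∷ gs) j
  rewrite Vecₚ.lookup-zipWith _+_ j (unitVec g) (colourVector gs) | lookup-unitVec g j | lookup-colourVector gs j
  with toℕ g ≡ᵇ toℕ j
... | true = refl
... | false = refl

colourCount : ∀ {r} → List (Fin r) → Vec ℕ r
colourCount gs = V.tabulate (λ j → length (filter (λ g → toℕ g ≟ toℕ j) gs))

colourVector≡colourCount : ∀ {r} (gs : List (Fin r)) → colourVector gs ≡ colourCount gs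
colourVector≡colourCount gs =
  trans (sym (Vecₚ.tabulate∘lookup (colourVector gs))) (Vecₚ.tabulate-cong (lookup-colourVector gs))

-- Statistics of a coloured word

cols : ∀ {r} → List (CInt r) → List (Fin r)
cols = map proj₂

DesOf : ∀ {r} → List (Fin r) → List ℕ → List ℕ
DesOf [] D = D
DesOf (g ∷ _) D = if toℕ g ≡ᵇ 0 then D else 0 ∷ D

length-DesOf : ∀ {r} (gs : List (Fin r)) D → length (DesOf gs D) ≡ des₀ gs + length D
length-DesOf [] D = refl
length-DesOf (g ∷ _) D with toℕ g ≡ᵇ 0
... | true = refl
... | false = refl

sum-DesOf : ∀ {r} (gs : List (Fin r)) D L → sum (map (L ∸_) (DesOf gs D)) ≡ des₀ gs * L + sum (map (L ∸_) D)
sum-DesOf [] D L = refl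
sum-DesOf (g ∷ _) D L with toℕ g ≡ᵇ 0
... | true = refl
... | false = cong (_+ sum (map (L ∸_) D)) (sym (+-identityʳ L))

DesW : ∀ {r} → List (CInt r) → List ℕ
DesW w = DesOf (cols w) (desStarFrom 1 w)

desW : ∀ {r} → List (CInt r) → ℕ
desW w = length (DesW w)

leadW : ∀ {r} → List (CInt r) → Mon r
leadW w = colourCount (cols w) , sum (map (length w ∸_) (DesW w))

desW-cons : ∀ {r} (x : CInt r) w → desW (x ∷ w) ≡ des₀ (cols (x ∷ w)) + descentsAfter x w
desW-cons x w = trans (length-DesOf (cols (x ∷ w)) _) (cong (des₀ (cols (x ∷ w)) +_) (length-desStarFrom 1 x w))

-- the least admissible index sequence; ψ_m does not kill its monomial once m > des
minimalSeq : ∀ {r} → List (CInt r) → List ℕ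
minimalSeq [] = []
minimalSeq (x ∷ w) = suc (des₀ (cols (x ∷ w))) ∷ minimalAfter (suc (des₀ (cols (x ∷ w)))) x w

length-minimalSeq : ∀ {r} (w : List (CInt r)) → length (minimalSeq w) ≡ length w
length-minimalSeq [] = refl
length-minimalSeq (x ∷ w) = cong suc (length-minimalAfter _ x w)

admissible-minimalSeq : ∀ {r} (w : List (CInt r)) → T (admissibleFrom (desStarFrom 1 w) 1 (minimalSeq w))
admissible-minimalSeq [] = _
admissible-minimalSeq (x ∷ w) =
  subst T (sym (admissibleFrom-desStarFrom 1 x w _ _ (length-minimalAfter _ x w))) (admissibleAfter-minimal _ x w)

survives-intro : ∀ {r} m i (g : Fin r) → 1 ≤ i → i ≤ m → toℕ g ≡ 0 ⊎ 1 < i → Survives m i g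
survives-intro m i g 1≤i i≤m colour-or-1<i =
  from T-∧ (≤⇒≤ᵇ 1≤i , from T-∧ (≤⇒≤ᵇ i≤m , from T-∨ (colour colour-or-1<i)))
  where
  colour : toℕ g ≡ 0 ⊎ 1 < i → T (toℕ g ≡ᵇ 0) ⊎ T (1 <ᵇ i)
  colour (inj₁ g≡0) = inj₁ (≡⇒≡ᵇ (toℕ g) 0 g≡0)
  colour (inj₂ 1<i) = inj₂ (<⇒<ᵇ 1<i)

colour-descent : ∀ {r} (x y : CInt r) → toℕ (proj₂ x) ≡ 0 → toℕ (proj₂ y) ≢ 0 → indicator (y <ᶜ x) ≡ 1
colour-descent (_ , g₁) (_ , g₂) g₁≡0 g₂≢0 rewrite g₁≡0 with toℕ g₂
... | zero = ⊥-elim (g₂≢0 refl)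
... | suc _ = refl

-- Invariant: after the first nonzero colour the index is ≥ 2, because a letter of nonzero colour
-- following one of colour 0 is a descent.
minimalAfter-survives : ∀ {r} c m (x : CInt r) w → 1 ≤ c → toℕ (proj₂ x) ≡ 0 ⊎ 1 < c →
  c + descentsAfter x w ≤ m → Pointwise (Survives m) (c ∷ minimalAfter c x w) (proj₂ x ∷ cols w)
minimalAfter-survives c m x w 1≤c colour-or-1<c bound =
  survives-intro m c (proj₂ x) 1≤c (≤-trans (m≤m+n c _) bound) colour-or-1<c ∷ tail w bound
  where
  tail : ∀ w → c + descentsAfter x w ≤ m → Pointwise (Survives m) (minimalAfter c x w) (cols w)
  tail [] _ = []
  tail (y ∷ w) bound =
    minimalAfter-survives (c + δ) m y w (≤-trans 1≤c (m≤m+n c δ)) next (subst (_≤ m) (sym (+-assoc c δ _)) bound)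
    where
    δ = indicator (y <ᶜ x)
    next : toℕ (proj₂ y) ≡ 0 ⊎ 1 < c + δ
    next with toℕ (proj₂ y) ≟ 0
    ... | yes y≡0 = inj₁ y≡0
    ... | no y≢0 = inj₂ (climbed colour-or-1<c)
      where
      climbed : toℕ (proj₂ x) ≡ 0 ⊎ 1 < c → 1 < c + δ
      climbed (inj₂ 1<c) = ≤-trans 1<c (m≤m+n c δ)
      climbed (inj₁ x≡0) = subst (λ d → 1 < c + d) (sym (colour-descent x y x≡0 y≢0)) (+-monoˡ-≤ 1 1≤c)

first-colour-or-1< : ∀ {r} (g : Fin r) gs → toℕ g ≡ 0 ⊎ 1 < suc (des₀ (g ∷ gs))
first-colour-or-1< g gs with toℕ g ≡ᵇ 0 in g≡ᵇ0
... | true = inj₁ (≡ᵇ⇒≡ (toℕ g) 0 (from T-≡ g≡ᵇ0))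
... | false = inj₂ ≤-refl

survives-minimalSeq : ∀ {r} (w : List (CInt r)) → Pointwise (Survives (suc (desW w))) (minimalSeq w) (cols w)
survives-minimalSeq [] = []
survives-minimalSeq (x ∷ w) =
  minimalAfter-survives _ _ x w (s≤s z≤n) (first-colour-or-1< (proj₂ x) (cols w))
    (≤-reflexive (cong suc (sym (desW-cons x w))))

map-pred-minimalAfter : ∀ {r} c (x : CInt r) w → map (_∸ 1) (minimalAfter (suc c) x w) ≡ minimalAfter c x w
map-pred-minimalAfter c x [] = refl
map-pred-minimalAfter c x (y ∷ w) = cong (_ ∷_) (map-pred-minimalAfter _ y w)

-- the minimal sequence starting at c is c + (number of descents so far), so the descent
-- between positions p and p + 1 is counted once by each of the N - p later entries
sum-minimalAfter : ∀ {r} c k N (x : CInt r) w → N ≡ k + length w →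
  sum (c ∷ minimalAfter c x w) ≡ c * suc (length w) + sum (map (N ∸_) (desStarFrom k (x ∷ w)))
sum-minimalAfter c k N x [] _ = cong (_+ 0) (sym (*-identityʳ c))
sum-minimalAfter c k N x (y ∷ w) N≡k+len with y <ᶜ x
... | true = begin
  c + sum (c + 1 ∷ minimalAfter (c + 1) y w)                ≡⟨ cong (c +_) (ih (c + 1)) ⟩
  c + ((c + 1) * suc (length w) + S)                        ≡⟨ arith c (length w) S ⟩
  c * suc (suc (length w)) + (suc (length w) + S)           ≡⟨ cong (λ t → c * suc (suc (length w)) + (t + S)) N∸k ⟨
  c * suc (suc (length w)) + (N ∸ k + S)                    ∎
  where
  S = sum (map (N ∸_) (desStarFrom (suc k) (y ∷ w)))
  ih : ∀ c′ → sum (c′ ∷ minimalAfter c′ y w) ≡ c′ * suc (length w) + S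
  ih c′ = sum-minimalAfter c′ (suc k) N y w (trans N≡k+len (+-suc k (length w)))
  N∸k : N ∸ k ≡ suc (length w)
  N∸k = trans (cong (_∸ k) N≡k+len) (m+n∸m≡n k (suc (length w)))
  arith : ∀ c l S → c + ((c + 1) * suc l + S) ≡ c * suc (suc l) + (suc l + S)
  arith = solve-∀
... | false =
  trans (cong (c +_) (sum-minimalAfter (c + 0) (suc k) N y w (trans N≡k+len (+-suc k (length w)))))
        (arith c (length w) _)
  where
  arith : ∀ c l S → c + ((c + 0) * suc l + S) ≡ c * suc (suc l) + S
  arith = solve-∀

leadW-minimalSeq : ∀ {r} (w : List (CInt r)) → leadW w ≡ (colourVector (cols w) , sum (map (_∸ 1) (minimalSeq w)))
leadW-minimalSeq w = cong₂ _,_ (sym (colourVector≡colourCount (cols w))) (comaj-minimal w)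
  where
  comaj-minimal : ∀ w → sum (map (length w ∸_) (DesW w)) ≡ sum (map (_∸ 1) (minimalSeq w))
  comaj-minimal [] = refl
  comaj-minimal (x ∷ w) = begin
    sum (map (L ∸_) (DesOf (cols (x ∷ w)) D))  ≡⟨ sum-DesOf (cols (x ∷ w)) D L ⟩
    e * L + sum (map (L ∸_) D)                  ≡⟨ sum-minimalAfter e 1 L x w refl ⟨
    sum (e ∷ minimalAfter e x w)                ≡⟨ cong (λ t → e + sum t) (map-pred-minimalAfter e x w) ⟨
    sum (map (_∸ 1) (minimalSeq (x ∷ w)))       ∎
    where
    L = suc (length w)
    e = des₀ (cols (x ∷ w))
    D = desStarFrom 1 (x ∷ w)

admissible-bound : ∀ {r} d (w : List (CInt r)) s → length s ≡ length w →
  Pointwise (Survives (suc d)) s (cols w) → T (admissibleFrom (desStarFrom 1 w) 1 s) →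
  desW w ≤ d × (desW w ≡ d → s ≡ minimalSeq w)
admissible-bound d [] [] _ _ _ = z≤n , λ _ → refl
admissible-bound d (x ∷ w) (i ∷ s) len svs@(sv ∷ _) adm =
  ≤-pred (subst (_≤ suc d) (cong suc (sym (desW-cons x w))) bound) ,
  λ des≡d → minimal (cong suc (trans (sym (desW-cons x w)) des≡d))
  where
  core = admissibleAfter-bound _ (suc d) x w i s (suc-injective len)
           (subst T (admissibleFrom-desStarFrom 1 x w i s (suc-injective len)) adm)
           (survives-des₀ (suc d) i (proj₂ x) (cols w) sv)
           (All.map proj₂ (survives-bounded (suc d) (i ∷ s) _ svs))
  bound = proj₁ core
  minimal = proj₂ core

-- Coefficients of Ψ(F_b)

monEq⇒≡ : ∀ {r} (o : Maybe (Mon r)) μ → T (monEq o μ) → o ≡ just μ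
monEq⇒≡ (just (α , e)) (β , f) same with Vecₚ.≡-dec _≟_ α β
... | yes refl = cong (λ f → just (α , f)) (≡ᵇ⇒≡ e f same)

≡just⇒monEq : ∀ {r} (o : Maybe (Mon r)) μ → o ≡ just μ → T (monEq o μ)
≡just⇒monEq _ (α , e) refl rewrite dec-true (Vecₚ.≡-dec _≟_ α α) refl = ≡⇒≡ᵇ e e refl

allSeqs-length : ∀ n m → All (λ s → length s ≡ n) (allSeqs n m)
allSeqs-length zero m = refl ∷ []
allSeqs-length (suc n) m = Allₚ.concat⁺ (Allₚ.map⁺ (All.universal extend (map suc (upTo m))))
  where
  extend : ∀ v → All (λ s → length s ≡ suc n) (map (v ∷_) (allSeqs n m))
  extend v = Allₚ.map⁺ (All.map (cong suc) (allSeqs-length n m))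

∈-allSeqs : ∀ s m → All (λ i → 1 ≤ i × i ≤ m) s → s ∈ allSeqs (length s) m
∈-allSeqs [] m [] = here refl
∈-allSeqs (suc i ∷ s) m ((_ , i<m) ∷ bounded) =
  ∈-concatMap⁺ (λ v → map (v ∷_) (allSeqs (length s) m))
    (lose (∈-map⁺ suc (∈-upTo⁺ i<m)) (∈-map⁺ (suc i ∷_) (∈-allSeqs s m bounded)))

-- the monomial of the leading term t^{des} p^{col} x^{comaj} of Ψ(F_b)
lead : ∀ {r} → CPerm r → Mon r
lead b = col b , comaj b

contributes : ∀ {r} → ℕ → CPerm r → Mon r → List ℕ → Bool
contributes m b μ s = admissibleFrom (DesStar b) 1 s ∧ monEq (specMono m s (colours b)) μ

module _ {r} (b : CPerm r) where

  private
    w = word b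

  colours≡cols : colours b ≡ cols w
  colours≡cols = sym (map-tabulate _ proj₂)

  length-word : length w ≡ n b
  length-word = length-tabulate _

  Des≡DesW : Des b ≡ DesW w
  Des≡DesW = trans Des≡DesOf (cong (λ gs → DesOf gs (DesStar b)) colours≡cols)
    where
    Des≡DesOf : Des b ≡ DesOf (colours b) (DesStar b)
    Des≡DesOf with colours b
    ... | [] = refl
    ... | _ ∷ _ = refl

  des≡desW : des b ≡ desW w
  des≡desW = cong length Des≡DesW

  lead≡leadW : lead b ≡ leadW w
  lead≡leadW =
    cong₂ _,_ (cong colourCount colours≡cols) (cong₂ (λ L D → sum (map (L ∸_) D)) (sym length-word) Des≡DesW)

  private
    monomial : List ℕ → Mon r
    monomial s = colourVector (cols w) , sum (map (_∸ 1) s)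

    lead≡minimal : lead b ≡ monomial (minimalSeq w)
    lead≡minimal = trans lead≡leadW (leadW-minimalSeq w)

  contributes-bound : ∀ d μ s → length s ≡ n b → T (contributes (suc d) b μ s) →
    des b ≤ d × (des b ≡ d → μ ≡ lead b)
  contributes-bound d μ s len contrib =
    subst (_≤ d) (sym des≡desW) (proj₁ bound) ,
    λ des≡d → begin
      μ                        ≡⟨ just-injective (trans (sym spec≡μ) (specMono-survives _ s _ survivors)) ⟩
      monomial s               ≡⟨ cong monomial (proj₂ bound (trans (sym des≡desW) des≡d)) ⟩
      monomial (minimalSeq w)  ≡⟨ lead≡minimal ⟨
      lead b                   ∎
    where
    len′ : length s ≡ length w
    len′ = trans len (sym length-word)
    adm = proj₁ (to (T-∧ {admissibleFrom (DesStar b) 1 s}) contrib)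
    spec≡μ : specMono (suc d) s (cols w) ≡ just μ
    spec≡μ = subst (λ gs → specMono (suc d) s gs ≡ just μ) colours≡cols
               (monEq⇒≡ _ μ (proj₂ (to (T-∧ {admissibleFrom (DesStar b) 1 s}) contrib)))
    survivors = specMono≡just⇒survives (suc d) s (cols w) (trans len′ (sym (length-map proj₂ w))) spec≡μ
    bound = admissible-bound d w s len′ survivors adm

  minimalSeq-contributes : T (contributes (suc (des b)) b (lead b) (minimalSeq w))
  minimalSeq-contributes = from T-∧ (admissible-minimalSeq w , ≡just⇒monEq _ (lead b) spec≡lead)
    where
    spec≡lead : specMono (suc (des b)) (minimalSeq w) (colours b) ≡ just (lead b)
    spec≡lead = begin
      specMono (suc (des b)) (minimalSeq w) (colours b)  ≡⟨ cong₂ (λ d → specMono (suc d) (minimalSeq w)) des≡desW colours≡cols ⟩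
      specMono (suc (desW w)) (minimalSeq w) (cols w)    ≡⟨ specMono-survives _ _ _ (survives-minimalSeq w) ⟩
      just (monomial (minimalSeq w))                     ≡⟨ cong just lead≡minimal ⟨
      just (lead b)                                      ∎

  ψcoeff-vanishes : ∀ m μ → (∀ s → length s ≡ n b → T (contributes m b μ s) → ⊥) → ψcoeff m b μ ≡ 0
  ψcoeff-vanishes m μ never =
    cong length (filter-none (λ s → T? (contributes m b μ s))
                             (All.map (λ {s} → never s) (allSeqs-length (n b) m)))

  Ψcoeff-below : ∀ d μ → d < des b → Ψcoeff b d μ ≡ 0ℚ
  Ψcoeff-below d μ d<des = cong (λ k → (ℤ.+ k) / 1) (ψcoeff-vanishes (suc d) μ λ s len contrib →
    <⇒≱ d<des (proj₁ (contributes-bound d μ s len contrib)))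

  Ψcoeff-off-lead : ∀ μ → μ ≢ lead b → Ψcoeff b (des b) μ ≡ 0ℚ
  Ψcoeff-off-lead μ μ≢lead = cong (λ k → (ℤ.+ k) / 1) (ψcoeff-vanishes _ μ λ s len contrib →
    μ≢lead (proj₂ (contributes-bound (des b) μ s len contrib) refl))

  Ψcoeff-lead : Ψcoeff b (des b) (lead b) ≢ 0ℚ
  Ψcoeff-lead = fromℕ≢0 _ (>⇒≢ (filter-some (λ s → T? (contributes (suc (des b)) b (lead b) s))
                                            (lose minimal∈ minimalSeq-contributes)))
    where
    minimal∈ : minimalSeq w ∈ allSeqs (n b) (suc (des b))
    minimal∈ = subst₂ (λ k d → minimalSeq w ∈ allSeqs k (suc d))
                 (trans (length-minimalSeq w) length-word) (sym des≡desW)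
                 (∈-allSeqs _ _ (survives-bounded _ _ _ (survives-minimalSeq w)))

lemma4p4 : (r : ℕ) → 1 ≤ r → (k : ℕ) → (a : Fin k → CPerm r) →
    (∀ i j → stat (a i) ≡ stat (a j) → i ≡ j) →
    LinIndepΨ a
lemma4p4 r _ k a distinct =
  triangular⇒independent (λ i → Ψcoeff (a i)) (λ i → des (a i)) (λ i → lead (a i))
    (λ i j des≡ lead≡ → distinct i j (cong₂ _,_ des≡ (cong₂ _,_ (cong proj₂ lead≡) (cong proj₁ lead≡))))
    (λ i → Ψcoeff-lead (a i))
    (λ i → Ψcoeff-below (a i))
    (λ i → Ψcoeff-off-lead (a i))
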